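{- Let $a\ge b\ge 0$ be integers with $a\ge 1$, let $\mu=(2^b,1^{a-b})$ and $n=a+b$. For every standard filling $S$ of $\mu$, the rational function $\varphi_S$ (defined in the context) is a polynomial in $\mathbb{Q}[x_1,\dots,x_n;y_1,\dots,y_n]$.
   Context: Diagrams are drawn in French convention: rows are numbered $1,2,\dots$ from the bottom, rows are left-justified and their lengths weakly decrease going up; columns are numbered $1$ (left) and $2$ (right). Fix distinct rational numbers $\alpha_1,\dots,\alpha_n$ and distinct rational numbers $\beta_1,\dots,\beta_n$. A standard filling of $\mu$ is a bijection from the cells of $\mu$ to $\{1,\dots,n\}$. Labelled fillings: a labelled filling of size $N\ge1$ is a bijective filling of the diagram of a partition $\nu$ of $N$ with at most two columns by $1,\dots,N$, together with a label $\ell(R)\in\{1,\dots,a\}$ for each row $R$ of $\nu$. A standard filling of $\mu$ is regarded as a labelled filling by giving the row numbered $r$ the label $r$. For a labelled filling $S$ of size $N\ge2$, $S\setminus N$ is the labelled filling of size $N-1$ obtained by deleting the cell containing $N$ and straightening: if the row of $N$ had length $2$, the other entry of that row becomes a row of length $1$ (in column 1) placed above all rows of length $2$ and below all rows of length $1$, the other rows keeping their relative order; if the row of $N$ had length $1$, that row is deleted and the rows above slide down. Every remaining row keeps its label (the newly created length-one row keeps the label of the row that contained $N$). Row preference: for a labelled filling $S$ and an entry $k$ of $S$, erase from $S$ all entries $\le k$. The rows having at least one empty cell are totally ordered as follows: first the completely empty rows of length $2$ from top to bottom, then the completely empty rows of length $1$ from top to bottom, then the rows of length $2$ containing exactly one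 remaining entry, in decreasing order of that entry. Write $R'\succ_k R$ if $R'$ precedes $R$ in this order. Definition of $\varphi_S$ (a rational function in $x_1,\dots,x_N,y_1,\dots,y_N$ for $S$ of size $N$): if $N=1$, $\varphi_S=1$. If $N\ge2$, $S$ has shape $\nu$ and $N$ lies in row $R$, then $\varphi_S=\varphi_{S\setminus N}\cdot\prod_{R'\succ_N R}(x_N-\alpha_{\ell(R')})\cdot E_S$, where: $E_S=1$ if $N$ is the rightmost cell of $R$; if $R$ has length $2$ and $N$ is in column $1$, let $k$ be the entry of $R$ in column $2$; then $E_S=y_k-\beta_1$ if $\nu=(2^c)$ for some $c$ (a rectangle), and otherwise $E_S=\dfrac{(y_k-\beta_1)\prod_{R\succ_k R''}(x_k-\alpha_{\ell(R'')})}{\prod_{R'\succ_k R}(x_k-\alpha_{\ell(R')})}$, where $\succ_k$ is computed in $S$. -}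

module Defs where

open import Data.Nat using (ℕ; zero; suc; _≤_; _≡ᵇ_; _≤ᵇ_; _<ᵇ_)
open import Data.Bool using (Bool; true; false; if_then_else_; _∧_; _∨_; not)
open import Data.List using (List; []; _∷_; _++_; map; reverse; foldr)
open import Data.Vec using (Vec)
open import Data.Maybe using (Maybe; just; nothing)
open import Data.Product using (_×_; _,_; proj₁; proj₂; Σ)
open import Data.Fin using (Fin; toℕ)
open import Data.Rational using (ℚ; 1ℚ; _+_; _*_; _-_)
open import Relation.Binary.PropositionalEquality using (_≡_)

-- Labelled fillings (French convention).
-- A filling is a list of rows, listed from the BOTTOM row (row 1) upward.
-- Entries are positive naturals; each row carries a label.

data Row : Set where
  one : (e l : ℕ) → Row
  two : (e₁ e₂ l : ℕ) → Row

Filling : Set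
Filling = List Row

label : Row → ℕ
label (one e l) = l
label (two e₁ e₂ l) = l

-- The standard filling of μ = (2^b, 1^(a-b)) given by its first column
-- (a entries, bottom to top) and its second column (b entries, bottom to top);
-- the row numbered r gets the label r.
stdFillingFrom : ℕ → List ℕ → List ℕ → Filling
stdFillingFrom r [] _ = []
stdFillingFrom r (c ∷ cs) [] = one c r ∷ stdFillingFrom (suc r) cs []
stdFillingFrom r (c ∷ cs) (d ∷ ds) = two c d r ∷ stdFillingFrom (suc r) cs ds

stdFilling : ∀ {a b} → Vec ℕ a → Vec ℕ b → Filling
stdFilling c₁ c₂ = stdFillingFrom 1 (Data.Vec.toList c₁) (Data.Vec.toList c₂)

extract : ℕ → Filling → Filling × Maybe Row
extract N [] = [] , nothing
extract N (one e l ∷ rs) with e ≡ᵇ N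
... | true  = rs , nothing
... | false with extract N rs
...   | (rs' , m) = one e l ∷ rs' , m
extract N (two e₁ e₂ l ∷ rs) with e₁ ≡ᵇ N | e₂ ≡ᵇ N
... | true  | _     = rs , just (one e₂ l)
... | false | true  = rs , just (one e₁ l)
... | false | false with extract N rs
...   | (rs' , m) = two e₁ e₂ l ∷ rs' , m

insertOne : Row → Filling → Filling
insertOne r [] = r ∷ []
insertOne r (two e₁ e₂ l ∷ rs) = two e₁ e₂ l ∷ insertOne r rs
insertOne r (one e l ∷ rs) = r ∷ one e l ∷ rs

delete : ℕ → Filling → Filling
delete N S with extract N S
... | (rest , just r) = insertOne r rest
... | (rest , nothing) = rest

-- Location of an entry: row index (0-based from the bottom) and column

data Loc : Set where
  inOne  : (i : ℕ) → Loc
  inCol1 : (i : ℕ) (k : ℕ) → Loc      -- column 1 of a length-2 row whose column-2 entry is k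
  inCol2 : (i : ℕ) → Loc

shiftLoc : Loc → Loc
shiftLoc (inOne i) = inOne (suc i)
shiftLoc (inCol1 i k) = inCol1 (suc i) k
shiftLoc (inCol2 i) = inCol2 (suc i)

locate : ℕ → Filling → Maybe Loc
locate N [] = nothing
locate N (one e l ∷ rs) with e ≡ᵇ N
... | true = just (inOne 0)
... | false = Data.Maybe.map shiftLoc (locate N rs)
locate N (two e₁ e₂ l ∷ rs) with e₁ ≡ᵇ N | e₂ ≡ᵇ N
... | true  | _    = just (inCol1 0 e₂)
... | false | true = just (inCol2 0)
... | false | false = Data.Maybe.map shiftLoc (locate N rs)

locIndex : Loc → ℕ
locIndex (inOne i) = i
locIndex (inCol1 i k) = i
locIndex (inCol2 i) = i

-- Row preference ≻_k : the ordered list of (row index, label) of the rows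
-- having an empty cell after erasing all entries ≤ k.

indexed : ℕ → Filling → List (ℕ × Row)
indexed i [] = []
indexed i (r ∷ rs) = (i , r) ∷ indexed (suc i) rs

emptyTwos : ℕ → List (ℕ × Row) → List (ℕ × ℕ)
emptyTwos k [] = []
emptyTwos k ((i , one e l) ∷ xs) = emptyTwos k xs
emptyTwos k ((i , two e₁ e₂ l) ∷ xs) =
  if (e₁ ≤ᵇ k) ∧ (e₂ ≤ᵇ k) then (i , l) ∷ emptyTwos k xs else emptyTwos k xs

emptyOnes : ℕ → List (ℕ × Row) → List (ℕ × ℕ)
emptyOnes k [] = []
emptyOnes k ((i , one e l) ∷ xs) =
  if e ≤ᵇ k then (i , l) ∷ emptyOnes k xs else emptyOnes k xs
emptyOnes k ((i , two e₁ e₂ l) ∷ xs) = emptyOnes k xs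

halfTwos : ℕ → List (ℕ × Row) → List (ℕ × ℕ × ℕ)
halfTwos k [] = []
halfTwos k ((i , one e l) ∷ xs) = halfTwos k xs
halfTwos k ((i , two e₁ e₂ l) ∷ xs) with e₁ ≤ᵇ k | e₂ ≤ᵇ k
... | true  | false = (e₂ , i , l) ∷ halfTwos k xs
... | false | true  = (e₁ , i , l) ∷ halfTwos k xs
... | _     | _     = halfTwos k xs

insertDesc : ℕ × ℕ × ℕ → List (ℕ × ℕ × ℕ) → List (ℕ × ℕ × ℕ)
insertDesc x [] = x ∷ []
insertDesc (e , p) ((e' , p') ∷ ys) =
  if e' <ᵇ e then (e , p) ∷ (e' , p') ∷ ys else (e' , p') ∷ insertDesc (e , p) ys

sortDesc : List (ℕ × ℕ × ℕ) → List (ℕ × ℕ × ℕ)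
sortDesc = foldr insertDesc []

pref : ℕ → Filling → List (ℕ × ℕ)
pref k S =
  reverse (emptyTwos k (indexed 0 S))
  ++ reverse (emptyOnes k (indexed 0 S))
  ++ map proj₂ (sortDesc (halfTwos k (indexed 0 S)))

-- split the preference list at the row with index i:
-- (labels of rows R' ≻ R , labels of rows R'' with R ≻ R'')
splitAtRow : ℕ → List (ℕ × ℕ) → List ℕ × List ℕ
splitAtRow i [] = [] , []
splitAtRow i ((j , l) ∷ xs) with i ≡ᵇ j
... | true = [] , map proj₂ xs
... | false with splitAtRow i xs
...   | (pre , post) = l ∷ pre , post

isRectangle : Filling → Bool
isRectangle [] = true
isRectangle (one e l ∷ rs) = false
isRectangle (two e₁ e₂ l ∷ rs) = isRectangle rs

-- φ_S as a formal quotient of products of linear factors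

data Factor : Set where
  xf : (k j : ℕ) → Factor   -- x_k - α_j
  yf : (k : ℕ) → Factor     -- y_k - β_1

-- (numerator factors , denominator factors)
Frac : Set
Frac = List Factor × List Factor

_·_ : Frac → Frac → Frac
(n₁ , d₁) · (n₂ , d₂) = (n₁ ++ n₂) , (d₁ ++ d₂)

unitF : Frac
unitF = [] , []

Efactor : ℕ → Filling → Loc → Frac
Efactor N S (inOne i) = unitF
Efactor N S (inCol2 i) = unitF
Efactor N S (inCol1 i k) with isRectangle S
... | true = yf k ∷ [] , []
... | false with splitAtRow i (pref k S)
...   | (pre , post) = (yf k ∷ map (xf k) post) , map (xf k) pre

stepFactor : ℕ → Filling → Maybe Loc → Frac
stepFactor N S nothing = unitF
stepFactor N S (just loc) =
  (map (xf N) (proj₁ (splitAtRow (locIndex loc) (pref N S))) , [])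
  · Efactor N S loc

-- φ_S for S of size N (first argument)
phi : ℕ → Filling → Frac
phi zero S = unitF
phi (suc zero) S = unitF
phi (suc (suc m)) S =
  phi (suc m) (delete (suc (suc m)) S) · stepFactor (suc (suc m)) S (locate (suc (suc m)) S)

prodℚ : List ℚ → ℚ
prodℚ = foldr _*_ 1ℚ

evalFactor : (α : ℕ → ℚ) (β₁ : ℚ) (x y : ℕ → ℚ) → Factor → ℚ
evalFactor α β₁ x y (xf k j) = x k - α j
evalFactor α β₁ x y (yf k) = y k - β₁

evalProd : (α : ℕ → ℚ) (β₁ : ℚ) (x y : ℕ → ℚ) → List Factor → ℚ
evalProd α β₁ x y fs = prodℚ (map (evalFactor α β₁ x y) fs)

data Poly (n : ℕ) : Set where
  con  : ℚ → Poly n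
  X    : Fin n → Poly n        -- X i is x_{i+1}
  Y    : Fin n → Poly n        -- Y i is y_{i+1}
  _⊕_  : Poly n → Poly n → Poly n
  _⊗_  : Poly n → Poly n → Poly n

⟦_⟧ : ∀ {n} → Poly n → (x y : ℕ → ℚ) → ℚ
⟦ con c ⟧ x y = c
⟦ X i ⟧ x y = x (suc (toℕ i))
⟦ Y i ⟧ x y = y (suc (toℕ i))
⟦ p ⊕ q ⟧ x y = ⟦ p ⟧ x y + ⟦ q ⟧ x y
⟦ p ⊗ q ⟧ x y = ⟦ p ⟧ x y * ⟦ q ⟧ x y

-- The rational function numerator/denominator is a polynomial in
-- ℚ[x₁..xₙ, y₁..yₙ]: there is a polynomial P with P · denominator = numerator
-- (identity of polynomial functions on ℚ, equivalent to identity of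
-- polynomials since ℚ is infinite).
IsPolynomial : (n : ℕ) (α : ℕ → ℚ) (β₁ : ℚ) → Frac → Set
IsPolynomial n α β₁ (num , den) =
  Σ (Poly n) λ P → ∀ (x y : ℕ → ℚ) →
    ⟦ P ⟧ x y * evalProd α β₁ x y den ≡ evalProd α β₁ x y num

DistinctOn : ℕ → (ℕ → ℚ) → Set
DistinctOn n γ = ∀ i j → 1 ≤ i → i ≤ n → 1 ≤ j → j ≤ n → γ i ≡ γ j → i ≡ j

-- Deleting the largest entry from a standard filling of (2^b, 1^(a-b)) and straightening always
-- leaves a filling whose rows of length two lie below its rows of length one. Give each length-one
-- row R of such a filling, with entry e, the debt ∏_{R' ≻_e R} (x_e - α_ℓ(R')). By induction on the
-- size, the numerator of φ_S is, as a multiset of linear factors, its denominator times the debts of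
-- S times further factors in x₁…xₙ, y₁…yₙ. If N is alone in its row R, the new factor
-- ∏_{R' ≻_N R} (x_N - α_ℓ(R')) is exactly the debt of R. If N is in column 2, its partner becomes a
-- length-one row of S ∖ N whose debt is absorbed into the polynomial part. If N is in column 1 with
-- partner k, the denominator of E_S is exactly the debt of the length-one row formed by k in S ∖ N
-- (and E_S has no denominator in the rectangular case). The debts left at the end are polynomial, so
-- φ_S is.

module Submission where

open import Defs
import Algebra.Solver.CommutativeMonoid as CommutativeMonoidSolver
open import Data.Bool using (true; false; if_then_else_; _∧_)
open import Data.Bool.Properties using (T-≡; ¬-not; ∧-zeroʳ)
open import Data.Fin using (fromℕ<)
open import Data.Fin.Properties using (toℕ-fromℕ<)
open import Data.List using (List; []; _∷_; _++_; map; length; reverse; upTo; downFrom; applyDownFrom)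
open import Data.List.Properties
  using (length-++; length-map; map-++; ++-assoc; ++-identityʳ; reverse-++; unfold-reverse; reverse-map; reverse-upTo; map-downFrom)
open import Data.List.Membership.Propositional using (_∈_)
open import Data.List.Relation.Binary.Permutation.Propositional
  using (_↭_; prep; ↭-refl; ↭-reflexive; ↭-sym; ↭-trans; ↭⇒↭ₛ; module PermutationReasoning)
open import Data.List.Relation.Binary.Permutation.Propositional.Properties
  using (All-resp-↭; ∈-resp-↭; ↭-length; drop-∷; shift; shifts; ↭-reverse; ++⁺ˡ; ++⁺ʳ; map⁺; ++-commutativeMonoid)
open import Data.List.Relation.Binary.Permutation.Setoid.Properties using (foldr-commMonoid; Unique-resp-↭)
open import Data.List.Relation.Unary.All as All using (All; []; _∷_)
open import Data.List.Relation.Unary.All.Properties using (++⁺; ++⁻ˡ; ++⁻ʳ; applyDownFrom⁺₁)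
open import Data.List.Relation.Unary.AllPairs using (_∷_)
open import Data.List.Relation.Unary.Any using (here; there)
open import Data.List.Relation.Unary.Unique.Propositional using (Unique)
import Data.List.Relation.Unary.Unique.Propositional.Properties as Unique
open import Data.Maybe as Maybe using (just; nothing)
open import Data.Nat using (ℕ; zero; suc; z<s; z≤n; s≤s; _+_; _≤_; _<_; _≡ᵇ_; _≤ᵇ_; _<ᵇ_)
open import Data.Nat.Properties
open import Data.Product using (∃; ∃₂; _×_; _,_; proj₁; proj₂; map₁)
open import Data.Rational using (ℚ)
import Data.Rational as ℚ
import Data.Rational.Properties as ℚ
open import Data.Sum as Sum using (_⊎_; inj₁; inj₂)
open import Data.Vec using (Vec; toList)
open import Data.Vec.Properties using (length-toList)
open import Function using (Equivalence; _∘_; _∘′_)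
open import Relation.Binary.PropositionalEquality

module ++-Solver (X : Set) = CommutativeMonoidSolver (++-commutativeMonoid {A = X})

≡ᵇ-refl : ∀ n → (n ≡ᵇ n) ≡ true
≡ᵇ-refl n = Equivalence.to T-≡ (≡⇒≡ᵇ n n refl)

≢⇒≡ᵇ-false : ∀ {m n} → m ≢ n → (m ≡ᵇ n) ≡ false
≢⇒≡ᵇ-false {m} {n} m≢n = ¬-not (m≢n ∘′ ≡ᵇ⇒≡ m n ∘′ Equivalence.from T-≡)

<⇒≡ᵇ-false : ∀ {m n} → m < n → (m ≡ᵇ n) ≡ false
<⇒≡ᵇ-false = ≢⇒≡ᵇ-false ∘′ <⇒≢

≤⇒≤ᵇ-true : ∀ {m n} → m ≤ n → (m ≤ᵇ n) ≡ true
≤⇒≤ᵇ-true = Equivalence.to T-≡ ∘′ ≤⇒≤ᵇ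

>⇒≤ᵇ-false : ∀ {m n} → n < m → (m ≤ᵇ n) ≡ false
>⇒≤ᵇ-false {m} {n} n<m = ¬-not (<⇒≱ n<m ∘′ ≤ᵇ⇒≤ m n ∘′ Equivalence.from T-≡)

<⇒<ᵇ-true : ∀ {m n} → m < n → (m <ᵇ n) ≡ true
<⇒<ᵇ-true = Equivalence.to T-≡ ∘′ <⇒<ᵇ

>⇒<ᵇ-false : ∀ {m n} → n < m → (m <ᵇ n) ≡ false
>⇒<ᵇ-false {m} {n} n<m = ¬-not (<-asym n<m ∘′ <ᵇ⇒< m n ∘′ Equivalence.from T-≡)

-- Fillings in normal form

TwoRow : Set
TwoRow = ℕ × ℕ × ℕ

OneRow : Set
OneRow = ℕ × ℕ

twoRow : TwoRow → Row
twoRow (e₁ , e₂ , l) = two e₁ e₂ l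

oneRow : OneRow → Row
oneRow (e , l) = one e l

-- Every filling reached from a standard filling of (2^b, 1^(a-b)) by deleting largest entries has
-- this form.
filling : List TwoRow → List OneRow → Filling
filling tw on = map twoRow tw ++ map oneRow on

twoEntries : List TwoRow → List ℕ
twoEntries [] = []
twoEntries ((e₁ , e₂ , l) ∷ tw) = e₁ ∷ e₂ ∷ twoEntries tw

entries : List TwoRow → List OneRow → List ℕ
entries tw on = twoEntries tw ++ map proj₁ on

twoEntries-++ : ∀ A B → twoEntries (A ++ B) ≡ twoEntries A ++ twoEntries B
twoEntries-++ [] B = refl
twoEntries-++ ((a , b , _) ∷ A) B = cong (λ es → a ∷ b ∷ es) (twoEntries-++ A B)

entries-column₁ : ∀ {a b l} A B on → entries (A ++ (a , b , l) ∷ B) on ↭ a ∷ entries (A ++ B) ((b , l) ∷ on)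
entries-column₁ {a} {b} {l} A B on
  rewrite twoEntries-++ A ((a , b , l) ∷ B) | twoEntries-++ A B =
  solve 5 (λ a b A B O → (A ⊕ a ⊕ b ⊕ B) ⊕ O ⊜ a ⊕ (A ⊕ B) ⊕ b ⊕ O) ↭-refl
    (a ∷ []) (b ∷ []) (twoEntries A) (twoEntries B) (map proj₁ on)
  where open ++-Solver ℕ

entries-column₂ : ∀ {a b l} A B on → entries (A ++ (a , b , l) ∷ B) on ↭ b ∷ entries (A ++ B) ((a , l) ∷ on)
entries-column₂ {a} {b} {l} A B on
  rewrite twoEntries-++ A ((a , b , l) ∷ B) | twoEntries-++ A B =
  solve 5 (λ a b A B O → (A ⊕ a ⊕ b ⊕ B) ⊕ O ⊜ b ⊕ (A ⊕ B) ⊕ a ⊕ O) ↭-refl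
    (a ∷ []) (b ∷ []) (twoEntries A) (twoEntries B) (map proj₁ on)
  where open ++-Solver ℕ

entries-oneRow : ∀ {e l} tw A B → entries tw (A ++ (e , l) ∷ B) ↭ e ∷ entries tw (A ++ B)
entries-oneRow {e} {l} tw A B
  rewrite map-++ proj₁ A ((e , l) ∷ B) | map-++ proj₁ A B =
  solve 4 (λ e T A B → T ⊕ A ⊕ e ⊕ B ⊜ e ⊕ T ⊕ A ⊕ B) ↭-refl (e ∷ []) (twoEntries tw) (map proj₁ A) (map proj₁ B)
  where open ++-Solver ℕ

oneRowsFrom : ℕ → List ℕ → List OneRow
oneRowsFrom r [] = []
oneRowsFrom r (c ∷ cs) = (c , r) ∷ oneRowsFrom (suc r) cs

stdFillingFrom-oneRows : ∀ r cs → stdFillingFrom r cs [] ≡ filling [] (oneRowsFrom r cs)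
stdFillingFrom-oneRows r [] = refl
stdFillingFrom-oneRows r (c ∷ cs) = cong (one c r ∷_) (stdFillingFrom-oneRows (suc r) cs)

entries-oneRowsFrom : ∀ r cs → map proj₁ (oneRowsFrom r cs) ≡ cs
entries-oneRowsFrom r [] = refl
entries-oneRowsFrom r (c ∷ cs) = cong (c ∷_) (entries-oneRowsFrom (suc r) cs)

stdFillingFrom-filling : ∀ r cs ds → length ds ≤ length cs →
  ∃₂ λ tw on → stdFillingFrom r cs ds ≡ filling tw on × entries tw on ↭ cs ++ ds
stdFillingFrom-filling r [] [] _ = [] , [] , refl , ↭-refl
stdFillingFrom-filling r cs@(_ ∷ _) [] _ = [] , oneRowsFrom r cs , stdFillingFrom-oneRows r cs ,
  ↭-reflexive (trans (entries-oneRowsFrom r cs) (sym (++-identityʳ cs)))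
stdFillingFrom-filling r (c ∷ cs) (d ∷ ds) (s≤s ds≤cs) with stdFillingFrom-filling (suc r) cs ds ds≤cs
... | tw , on , S≡ , entries↭ = (c , d , r) ∷ tw , on , cong (two c d r ∷_) S≡ ,
  prep c (↭-trans (prep d entries↭) (↭-sym (shift d cs ds)))

locate-two : ∀ {M a b} l S → a < M → b < M →
  locate M (two a b l ∷ S) ≡ Maybe.map shiftLoc (locate M S)
locate-two _ _ a<M b<M rewrite <⇒≡ᵇ-false a<M | <⇒≡ᵇ-false b<M = refl

locate-one : ∀ {M a} l S → a < M → locate M (one a l ∷ S) ≡ Maybe.map shiftLoc (locate M S)
locate-one _ _ a<M rewrite <⇒≡ᵇ-false a<M = refl

locate-column₁ : ∀ {M k l B on} A → All (_< M) (twoEntries A) →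
  locate M (filling (A ++ (M , k , l) ∷ B) on) ≡ just (inCol1 (length A) k)
locate-column₁ {M} [] _ rewrite ≡ᵇ-refl M = refl
locate-column₁ ((_ , _ , r) ∷ A) (a<M ∷ b<M ∷ A<M) =
  trans (locate-two r _ a<M b<M) (cong (Maybe.map shiftLoc) (locate-column₁ A A<M))

locate-column₂ : ∀ {M j l B on} A → All (_< M) (twoEntries A) → j < M →
  locate M (filling (A ++ (j , M , l) ∷ B) on) ≡ just (inCol2 (length A))
locate-column₂ {M} [] _ j<M rewrite <⇒≡ᵇ-false j<M | ≡ᵇ-refl M = refl
locate-column₂ ((_ , _ , r) ∷ A) (a<M ∷ b<M ∷ A<M) j<M =
  trans (locate-two r _ a<M b<M) (cong (Maybe.map shiftLoc) (locate-column₂ A A<M j<M))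

locate-oneRow : ∀ {M l B} tw A → All (_< M) (twoEntries tw) → All (_< M) (map proj₁ A) →
  locate M (filling tw (A ++ (M , l) ∷ B)) ≡ just (inOne (length tw + length A))
locate-oneRow {M} [] [] _ _ rewrite ≡ᵇ-refl M = refl
locate-oneRow [] ((_ , r) ∷ A) _ (a<M ∷ A<M) =
  trans (locate-one r _ a<M) (cong (Maybe.map shiftLoc) (locate-oneRow [] A [] A<M))
locate-oneRow ((_ , _ , r) ∷ tw) A (a<M ∷ b<M ∷ tw<M) A<M =
  trans (locate-two r _ a<M b<M) (cong (Maybe.map shiftLoc) (locate-oneRow tw A tw<M A<M))

extract-two : ∀ {M a b} l S → a < M → b < M →
  extract M (two a b l ∷ S) ≡ map₁ (two a b l ∷_) (extract M S)
extract-two _ _ a<M b<M rewrite <⇒≡ᵇ-false a<M | <⇒≡ᵇ-false b<M = refl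

extract-one : ∀ {M a} l S → a < M →
  extract M (one a l ∷ S) ≡ map₁ (one a l ∷_) (extract M S)
extract-one _ _ a<M rewrite <⇒≡ᵇ-false a<M = refl

extract-column₁ : ∀ {M k l B on} A → All (_< M) (twoEntries A) →
  extract M (filling (A ++ (M , k , l) ∷ B) on) ≡ (filling (A ++ B) on , just (one k l))
extract-column₁ {M} [] _ rewrite ≡ᵇ-refl M = refl
extract-column₁ ((_ , _ , r) ∷ A) (a<M ∷ b<M ∷ A<M) =
  trans (extract-two r _ a<M b<M) (cong (map₁ (_ ∷_)) (extract-column₁ A A<M))

extract-column₂ : ∀ {M j l B on} A → All (_< M) (twoEntries A) → j < M →
  extract M (filling (A ++ (j , M , l) ∷ B) on) ≡ (filling (A ++ B) on , just (one j l))
extract-column₂ {M} [] _ j<M rewrite <⇒≡ᵇ-false j<M | ≡ᵇ-refl M = refl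
extract-column₂ ((_ , _ , r) ∷ A) (a<M ∷ b<M ∷ A<M) j<M =
  trans (extract-two r _ a<M b<M) (cong (map₁ (_ ∷_)) (extract-column₂ A A<M j<M))

extract-oneRow : ∀ {M l B} tw A → All (_< M) (twoEntries tw) → All (_< M) (map proj₁ A) →
  extract M (filling tw (A ++ (M , l) ∷ B)) ≡ (filling tw (A ++ B) , nothing)
extract-oneRow {M} [] [] _ _ rewrite ≡ᵇ-refl M = refl
extract-oneRow [] ((_ , r) ∷ A) _ (a<M ∷ A<M) =
  trans (extract-one r _ a<M) (cong (map₁ (_ ∷_)) (extract-oneRow [] A [] A<M))
extract-oneRow ((_ , _ , r) ∷ tw) A (a<M ∷ b<M ∷ tw<M) A<M =
  trans (extract-two r _ a<M b<M) (cong (map₁ (_ ∷_)) (extract-oneRow tw A tw<M A<M))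

insertOne-filling : ∀ r tw on → insertOne (oneRow r) (filling tw on) ≡ filling tw (r ∷ on)
insertOne-filling r [] [] = refl
insertOne-filling r [] (_ ∷ _) = refl
insertOne-filling r (_ ∷ tw) on = cong (_ ∷_) (insertOne-filling r tw on)

delete-column₁ : ∀ {M k l B on} A → All (_< M) (twoEntries A) →
  delete M (filling (A ++ (M , k , l) ∷ B) on) ≡ filling (A ++ B) ((k , l) ∷ on)
delete-column₁ {k = k} {l} {B} {on} A A<M
  rewrite extract-column₁ {k = k} {l} {B} {on} A A<M = insertOne-filling (k , l) (A ++ B) on

delete-column₂ : ∀ {M j l B on} A → All (_< M) (twoEntries A) → j < M →
  delete M (filling (A ++ (j , M , l) ∷ B) on) ≡ filling (A ++ B) ((j , l) ∷ on)
delete-column₂ {j = j} {l} {B} {on} A A<M j<M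
  rewrite extract-column₂ {l = l} {B} {on} A A<M j<M = insertOne-filling (j , l) (A ++ B) on

delete-oneRow : ∀ {M l B} tw A → All (_< M) (twoEntries tw) → All (_< M) (map proj₁ A) →
  delete M (filling tw (A ++ (M , l) ∷ B)) ≡ filling tw (A ++ B)
delete-oneRow {l = l} {B} tw A tw<M A<M rewrite extract-oneRow {l = l} {B} tw A tw<M A<M = refl

-- The preference order ≻_k

emptyTwoLabels : ℕ → List TwoRow → List ℕ
emptyTwoLabels e [] = []
emptyTwoLabels e ((a , b , l) ∷ tw) =
  if (a ≤ᵇ e) ∧ (b ≤ᵇ e) then l ∷ emptyTwoLabels e tw else emptyTwoLabels e tw

emptyOneLabels : ℕ → List OneRow → List ℕ
emptyOneLabels e [] = []
emptyOneLabels e ((a , l) ∷ on) = if a ≤ᵇ e then l ∷ emptyOneLabels e on else emptyOneLabels e on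

emptyOneLabelsAbove : ℕ → List OneRow → List ℕ
emptyOneLabelsAbove e [] = []
emptyOneLabelsAbove e ((a , l) ∷ on) = if a ≡ᵇ e then emptyOneLabels e on else emptyOneLabelsAbove e on

-- The labels of the rows R' ≻_e R, in ≻_e order, where R is the length-one row holding e.
precedingLabels : ℕ → List TwoRow → List OneRow → List ℕ
precedingLabels e tw on = reverse (emptyTwoLabels e tw) ++ reverse (emptyOneLabelsAbove e on)

indexed-++ : ∀ s xs ys → indexed s (xs ++ ys) ≡ indexed s xs ++ indexed (s + length xs) ys
indexed-++ s [] ys = cong (λ t → indexed t ys) (sym (+-identityʳ s))
indexed-++ s (x ∷ xs) ys = cong ((s , x) ∷_)
  (trans (indexed-++ (suc s) xs ys) (cong (λ t → indexed (suc s) xs ++ indexed t ys) (sym (+-suc s (length xs)))))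

indexed-bounds : ∀ s xs → All (λ p → s ≤ proj₁ p × proj₁ p < s + length xs) (indexed s xs)
indexed-bounds s [] = []
indexed-bounds s (x ∷ xs) = (≤-refl , m<m+n s z<s) ∷ All.map (λ {p} → widen p) (indexed-bounds (suc s) xs)
  where
  widen : ∀ p → suc s ≤ proj₁ p × proj₁ p < suc s + length xs → s ≤ proj₁ p × proj₁ p < s + suc (length xs)
  widen p (lo , hi) = <⇒≤ lo , subst (proj₁ p <_) (sym (+-suc s (length xs))) hi

emptyTwos-++ : ∀ k xs ys → emptyTwos k (xs ++ ys) ≡ emptyTwos k xs ++ emptyTwos k ys
emptyTwos-++ k [] ys = refl
emptyTwos-++ k ((i , one e l) ∷ xs) ys = emptyTwos-++ k xs ys
emptyTwos-++ k ((i , two a b l) ∷ xs) ys with (a ≤ᵇ k) ∧ (b ≤ᵇ k)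
... | true = cong ((i , l) ∷_) (emptyTwos-++ k xs ys)
... | false = emptyTwos-++ k xs ys

emptyOnes-++ : ∀ k xs ys → emptyOnes k (xs ++ ys) ≡ emptyOnes k xs ++ emptyOnes k ys
emptyOnes-++ k [] ys = refl
emptyOnes-++ k ((i , two a b l) ∷ xs) ys = emptyOnes-++ k xs ys
emptyOnes-++ k ((i , one e l) ∷ xs) ys with e ≤ᵇ k
... | true = cong ((i , l) ∷_) (emptyOnes-++ k xs ys)
... | false = emptyOnes-++ k xs ys

halfTwos-++ : ∀ k xs ys → halfTwos k (xs ++ ys) ≡ halfTwos k xs ++ halfTwos k ys
halfTwos-++ k [] ys = refl
halfTwos-++ k ((i , one e l) ∷ xs) ys = halfTwos-++ k xs ys
halfTwos-++ k ((i , two a b l) ∷ xs) ys with a ≤ᵇ k | b ≤ᵇ k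
... | true | true = halfTwos-++ k xs ys
... | true | false = cong ((b , i , l) ∷_) (halfTwos-++ k xs ys)
... | false | true = cong ((a , i , l) ∷_) (halfTwos-++ k xs ys)
... | false | false = halfTwos-++ k xs ys

emptyTwos-oneRows : ∀ k s on → emptyTwos k (indexed s (map oneRow on)) ≡ []
emptyTwos-oneRows k s [] = refl
emptyTwos-oneRows k s (_ ∷ on) = emptyTwos-oneRows k (suc s) on

halfTwos-oneRows : ∀ k s on → halfTwos k (indexed s (map oneRow on)) ≡ []
halfTwos-oneRows k s [] = refl
halfTwos-oneRows k s (_ ∷ on) = halfTwos-oneRows k (suc s) on

labels-emptyTwos : ∀ k s tw → map proj₂ (emptyTwos k (indexed s (map twoRow tw))) ≡ emptyTwoLabels k tw
labels-emptyTwos k s [] = refl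
labels-emptyTwos k s ((a , b , l) ∷ tw) with (a ≤ᵇ k) ∧ (b ≤ᵇ k)
... | true = cong (l ∷_) (labels-emptyTwos k (suc s) tw)
... | false = labels-emptyTwos k (suc s) tw

labels-emptyOnes : ∀ k s on → map proj₂ (emptyOnes k (indexed s (map oneRow on))) ≡ emptyOneLabels k on
labels-emptyOnes k s [] = refl
labels-emptyOnes k s ((a , l) ∷ on) with a ≤ᵇ k
... | true = cong (l ∷_) (labels-emptyOnes k (suc s) on)
... | false = labels-emptyOnes k (suc s) on

All-emptyTwos : ∀ {P : ℕ → Set} k xs → All (P ∘ proj₁) xs → All (P ∘ proj₁) (emptyTwos k xs)
All-emptyTwos k [] [] = []
All-emptyTwos k ((i , one e l) ∷ xs) (_ ∷ ps) = All-emptyTwos k xs ps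
All-emptyTwos k ((i , two a b l) ∷ xs) (p ∷ ps) with (a ≤ᵇ k) ∧ (b ≤ᵇ k)
... | true = p ∷ All-emptyTwos k xs ps
... | false = All-emptyTwos k xs ps

All-emptyOnes : ∀ {P : ℕ → Set} k xs → All (P ∘ proj₁) xs → All (P ∘ proj₁) (emptyOnes k xs)
All-emptyOnes k [] [] = []
All-emptyOnes k ((i , two a b l) ∷ xs) (_ ∷ ps) = All-emptyOnes k xs ps
All-emptyOnes k ((i , one e l) ∷ xs) (p ∷ ps) with e ≤ᵇ k
... | true = p ∷ All-emptyOnes k xs ps
... | false = All-emptyOnes k xs ps

halfTwos-below : ∀ k M s tw → All (_< M) (twoEntries tw) →
  All (λ p → proj₁ p < M) (halfTwos k (indexed s (map twoRow tw)))
halfTwos-below k M s [] [] = []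
halfTwos-below k M s ((a , b , l) ∷ tw) (a<M ∷ b<M ∷ tw<M) with a ≤ᵇ k | b ≤ᵇ k
... | true | true = halfTwos-below k M (suc s) tw tw<M
... | true | false = b<M ∷ halfTwos-below k M (suc s) tw tw<M
... | false | true = a<M ∷ halfTwos-below k M (suc s) tw tw<M
... | false | false = halfTwos-below k M (suc s) tw tw<M

insertDesc-top : ∀ x L → All (λ p → proj₁ p < proj₁ x) L → insertDesc x L ≡ x ∷ L
insertDesc-top x [] _ = refl
insertDesc-top (e , p) ((e' , p') ∷ ys) (e'<e ∷ _) rewrite <⇒<ᵇ-true e'<e = refl

All-insertDesc : ∀ {P : ℕ × ℕ × ℕ → Set} x L → P x → All P L → All P (insertDesc x L)
All-insertDesc x [] px _ = px ∷ []
All-insertDesc (e , p) ((e' , p') ∷ ys) px (py ∷ pys) with e' <ᵇ e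
... | true = px ∷ py ∷ pys
... | false = py ∷ All-insertDesc (e , p) ys px pys

All-sortDesc : ∀ {P : ℕ × ℕ × ℕ → Set} L → All P L → All P (sortDesc L)
All-sortDesc [] _ = []
All-sortDesc (x ∷ L) (px ∷ pL) = All-insertDesc x (sortDesc L) px (All-sortDesc L pL)

sortDesc-maximum : ∀ Xs x Ys → All (λ p → proj₁ p < proj₁ x) (Xs ++ Ys) →
  ∃ λ zs → sortDesc (Xs ++ x ∷ Ys) ≡ x ∷ zs
sortDesc-maximum [] x Ys below = sortDesc Ys , insertDesc-top x (sortDesc Ys) (All-sortDesc Ys below)
sortDesc-maximum ((e , p) ∷ Xs) (e' , p') Ys (e<e' ∷ below) with sortDesc-maximum Xs (e' , p') Ys below
... | zs , eq rewrite eq | >⇒<ᵇ-false e<e' = insertDesc (e , p) zs , refl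

splitAtRow-first : ∀ i l xs ys → All (λ p → i ≢ proj₁ p) xs →
  proj₁ (splitAtRow i (xs ++ (i , l) ∷ ys)) ≡ map proj₂ xs
splitAtRow-first i l [] ys _ rewrite ≡ᵇ-refl i = refl
splitAtRow-first i l ((j , l') ∷ xs) ys (i≢j ∷ h) rewrite ≢⇒≡ᵇ-false i≢j = cong (l' ∷_) (splitAtRow-first i l xs ys h)

indexed-middle : ∀ {X : Set} (f : X → Row) s A x B →
  indexed s (map f (A ++ x ∷ B)) ≡ indexed s (map f A) ++ (s + length A , f x) ∷ indexed (suc (s + length A)) (map f B)
indexed-middle f s A x B = begin
  indexed s (map f (A ++ x ∷ B))                         ≡⟨ cong (indexed s) (map-++ f A (x ∷ B)) ⟩
  indexed s (map f A ++ f x ∷ map f B)                   ≡⟨ indexed-++ s (map f A) (f x ∷ map f B) ⟩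
  indexed s (map f A) ++ indexed (s + length (map f A)) (f x ∷ map f B)
    ≡⟨ cong (λ t → indexed s (map f A) ++ indexed (s + t) (f x ∷ map f B)) (length-map f A) ⟩
  indexed s (map f A) ++ (s + length A , f x) ∷ indexed (suc (s + length A)) (map f B) ∎
  where open ≡-Reasoning

emptyTwos-filling : ∀ k s tw on → emptyTwos k (indexed s (filling tw on)) ≡ emptyTwos k (indexed s (map twoRow tw))
emptyTwos-filling k s [] on = emptyTwos-oneRows k s on
emptyTwos-filling k s ((a , b , l) ∷ tw) on with (a ≤ᵇ k) ∧ (b ≤ᵇ k)
... | true = cong ((s , l) ∷_) (emptyTwos-filling k (suc s) tw on)
... | false = emptyTwos-filling k (suc s) tw on

emptyOnes-filling : ∀ k s tw on →
  emptyOnes k (indexed s (filling tw on)) ≡ emptyOnes k (indexed (s + length tw) (map oneRow on))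
emptyOnes-filling k s [] on = cong (λ t → emptyOnes k (indexed t (map oneRow on))) (sym (+-identityʳ s))
emptyOnes-filling k s (_ ∷ tw) on = trans (emptyOnes-filling k (suc s) tw on)
  (cong (λ t → emptyOnes k (indexed t (map oneRow on))) (sym (+-suc s (length tw))))

halfTwos-filling : ∀ k s tw on → halfTwos k (indexed s (filling tw on)) ≡ halfTwos k (indexed s (map twoRow tw))
halfTwos-filling k s [] on = halfTwos-oneRows k s on
halfTwos-filling k s ((a , b , l) ∷ tw) on with a ≤ᵇ k | b ≤ᵇ k
... | true | true = halfTwos-filling k (suc s) tw on
... | true | false = cong ((b , s , l) ∷_) (halfTwos-filling k (suc s) tw on)
... | false | true = cong ((a , s , l) ∷_) (halfTwos-filling k (suc s) tw on)
... | false | false = halfTwos-filling k (suc s) tw on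

pref-components : ∀ k S {E₂ E₁ H} → emptyTwos k (indexed 0 S) ≡ E₂ → emptyOnes k (indexed 0 S) ≡ E₁ →
  halfTwos k (indexed 0 S) ≡ H → pref k S ≡ reverse E₂ ++ reverse E₁ ++ map proj₂ (sortDesc H)
pref-components k S refl refl refl = refl

All-reverse : ∀ {X : Set} {P : X → Set} xs → All P xs → All P (reverse xs)
All-reverse xs = All-resp-↭ (↭-sym (↭-reverse xs))

labels-reverse-++ : ∀ (E₂ E₁ : List (ℕ × ℕ)) →
  map proj₂ (reverse E₂ ++ reverse E₁) ≡ reverse (map proj₂ E₂) ++ reverse (map proj₂ E₁)
labels-reverse-++ E₂ E₁ =
  trans (map-++ proj₂ (reverse E₂) (reverse E₁)) (cong₂ _++_ (reverse-map proj₂ E₂) (reverse-map proj₂ E₁))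

reverse-middle : ∀ {X : Set} xs (x : X) ys → reverse (xs ++ x ∷ ys) ≡ reverse ys ++ x ∷ reverse xs
reverse-middle xs x ys = begin
  reverse (xs ++ x ∷ ys)              ≡⟨ reverse-++ xs (x ∷ ys) ⟩
  reverse (x ∷ ys) ++ reverse xs      ≡⟨ cong (_++ reverse xs) (unfold-reverse x ys) ⟩
  (reverse ys ++ x ∷ []) ++ reverse xs ≡⟨ ++-assoc (reverse ys) (x ∷ []) (reverse xs) ⟩
  reverse ys ++ x ∷ reverse xs        ∎
  where open ≡-Reasoning

emptyOneLabelsAbove-skip : ∀ {M l B} A → All (_< M) (map proj₁ A) →
  emptyOneLabelsAbove M (A ++ (M , l) ∷ B) ≡ emptyOneLabels M B
emptyOneLabelsAbove-skip {M} [] [] rewrite ≡ᵇ-refl M = refl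
emptyOneLabelsAbove-skip ((a , _) ∷ A) (a<M ∷ A<M) rewrite <⇒≡ᵇ-false a<M = emptyOneLabelsAbove-skip A A<M

emptyOnes-oneRow : ∀ M l tw A B →
  emptyOnes M (indexed 0 (filling tw (A ++ (M , l) ∷ B)))
    ≡ emptyOnes M (indexed (length tw) (map oneRow A)) ++ (length tw + length A , l)
        ∷ emptyOnes M (indexed (suc (length tw + length A)) (map oneRow B))
emptyOnes-oneRow M l tw A B
  rewrite emptyOnes-filling M 0 tw (A ++ (M , l) ∷ B) | indexed-middle oneRow (length tw) A (M , l) B
    | emptyOnes-++ M (indexed (length tw) (map oneRow A))
        ((length tw + length A , one M l) ∷ indexed (suc (length tw + length A)) (map oneRow B))
    | ≤⇒≤ᵇ-true (≤-refl {M}) = refl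

preceding-oneRow : ∀ M l tw A B → All (_< M) (map proj₁ A) →
  proj₁ (splitAtRow (length tw + length A) (pref M (filling tw (A ++ (M , l) ∷ B))))
    ≡ precedingLabels M tw (A ++ (M , l) ∷ B)
preceding-oneRow M l tw A B A<M = begin
  proj₁ (splitAtRow i (pref M S))
    ≡⟨ cong (proj₁ ∘ splitAtRow i) (pref-components M S (emptyTwos-filling M 0 tw on) (emptyOnes-oneRow M l tw A B) refl) ⟩
  proj₁ (splitAtRow i (reverse E₂ ++ reverse (EA ++ (i , l) ∷ EB) ++ H))
    ≡⟨ cong (λ z → proj₁ (splitAtRow i (reverse E₂ ++ z ++ H))) (reverse-middle EA (i , l) EB) ⟩
  proj₁ (splitAtRow i (reverse E₂ ++ (reverse EB ++ (i , l) ∷ reverse EA) ++ H))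
    ≡⟨ cong (proj₁ ∘ splitAtRow i) (regroup (reverse E₂) (reverse EB) (reverse EA)) ⟩
  proj₁ (splitAtRow i ((reverse E₂ ++ reverse EB) ++ (i , l) ∷ (reverse EA ++ H)))
    ≡⟨ splitAtRow-first i l _ _ (++⁺ (All-reverse E₂ E₂-below) (All-reverse EB EB-above)) ⟩
  map proj₂ (reverse E₂ ++ reverse EB)
    ≡⟨ labels-reverse-++ E₂ EB ⟩
  reverse (map proj₂ E₂) ++ reverse (map proj₂ EB)
    ≡⟨ cong₂ (λ u v → reverse u ++ reverse v) (labels-emptyTwos M 0 tw) (labels-emptyOnes M (suc i) B) ⟩
  reverse (emptyTwoLabels M tw) ++ reverse (emptyOneLabels M B)
    ≡⟨ cong (λ z → reverse (emptyTwoLabels M tw) ++ reverse z) (sym (emptyOneLabelsAbove-skip A A<M)) ⟩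
  precedingLabels M tw on ∎
  where
  open ≡-Reasoning
  on = A ++ (M , l) ∷ B
  S = filling tw on
  i = length tw + length A
  E₂ = emptyTwos M (indexed 0 (map twoRow tw))
  EA = emptyOnes M (indexed (length tw) (map oneRow A))
  EB = emptyOnes M (indexed (suc i) (map oneRow B))
  H = map proj₂ (sortDesc (halfTwos M (indexed 0 S)))
  regroup : ∀ (T R Q : List (ℕ × ℕ)) {x} → T ++ (R ++ x ∷ Q) ++ H ≡ (T ++ R) ++ x ∷ (Q ++ H)
  regroup T R Q {x} = trans (cong (T ++_) (++-assoc R (x ∷ Q) H)) (sym (++-assoc T R (x ∷ Q ++ H)))
  E₂-below : All (λ p → i ≢ proj₁ p) E₂
  E₂-below = All.map (λ { (_ , p<tw) → >⇒≢ (≤-trans (subst (_ <_) (length-map twoRow tw) p<tw) (m≤m+n _ _)) })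
    (All-emptyTwos M _ (indexed-bounds 0 (map twoRow tw)))
  EB-above : All (λ p → i ≢ proj₁ p) EB
  EB-above = All.map (λ { (i<p , _) → <⇒≢ i<p }) (All-emptyOnes M _ (indexed-bounds (suc i) (map oneRow B)))

emptyTwoLabels-++ : ∀ k xs ys → emptyTwoLabels k (xs ++ ys) ≡ emptyTwoLabels k xs ++ emptyTwoLabels k ys
emptyTwoLabels-++ k [] ys = refl
emptyTwoLabels-++ k ((a , b , l) ∷ xs) ys with (a ≤ᵇ k) ∧ (b ≤ᵇ k)
... | true = cong (l ∷_) (emptyTwoLabels-++ k xs ys)
... | false = emptyTwoLabels-++ k xs ys

emptyTwos-partner : ∀ {M k l on} A B → k < M →
  emptyTwos k (indexed 0 (filling (A ++ (M , k , l) ∷ B) on))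
    ≡ emptyTwos k (indexed 0 (map twoRow A)) ++ emptyTwos k (indexed (suc (length A)) (map twoRow B))
emptyTwos-partner {M} {k} {l} {on} A B k<M
  rewrite emptyTwos-filling k 0 (A ++ (M , k , l) ∷ B) on | indexed-middle twoRow 0 A (M , k , l) B
    | emptyTwos-++ k (indexed 0 (map twoRow A)) ((length A , two M k l) ∷ indexed (suc (length A)) (map twoRow B))
    | >⇒≤ᵇ-false k<M = refl

halfTwos-partner : ∀ {M k l on} A B → k < M →
  halfTwos k (indexed 0 (filling (A ++ (M , k , l) ∷ B) on))
    ≡ halfTwos k (indexed 0 (map twoRow A)) ++ (M , length A , l) ∷ halfTwos k (indexed (suc (length A)) (map twoRow B))
halfTwos-partner {M} {k} {l} {on} A B k<M
  rewrite halfTwos-filling k 0 (A ++ (M , k , l) ∷ B) on | indexed-middle twoRow 0 A (M , k , l) B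
    | halfTwos-++ k (indexed 0 (map twoRow A)) ((length A , two M k l) ∷ indexed (suc (length A)) (map twoRow B))
    | >⇒≤ᵇ-false k<M | ≤⇒≤ᵇ-true (≤-refl {k}) = refl

-- Erasing the entries ≤ k leaves M alone in its row, and M exceeds every other remaining entry, so that row
-- heads the half-empty rows: the rows before it are the empty ones, which are also the rows ≻_k the
-- length-one row that k forms once M is deleted.
preceding-partner : ∀ {M k l on} A B → k < M → All (_< M) (twoEntries A) → All (_< M) (twoEntries B) →
  proj₁ (splitAtRow (length A) (pref k (filling (A ++ (M , k , l) ∷ B) on)))
    ≡ precedingLabels k (A ++ B) ((k , l) ∷ on)
preceding-partner {M} {k} {l} {on} A B k<M A<M B<M = begin
  proj₁ (splitAtRow i (pref k S))
    ≡⟨ cong (proj₁ ∘ splitAtRow i)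
         (pref-components k S (emptyTwos-partner A B k<M) (emptyOnes-filling k 0 tw on) (halfTwos-partner A B k<M)) ⟩
  proj₁ (splitAtRow i (reverse (EA ++ EB) ++ reverse EO ++ map proj₂ (sortDesc (HA ++ (M , i , l) ∷ HB))))
    ≡⟨ cong (λ z → proj₁ (splitAtRow i (reverse (EA ++ EB) ++ reverse EO ++ map proj₂ z))) (proj₂ sorted) ⟩
  proj₁ (splitAtRow i (reverse (EA ++ EB) ++ reverse EO ++ (i , l) ∷ map proj₂ (proj₁ sorted)))
    ≡⟨ cong (proj₁ ∘ splitAtRow i) (sym (++-assoc (reverse (EA ++ EB)) (reverse EO) _)) ⟩
  proj₁ (splitAtRow i ((reverse (EA ++ EB) ++ reverse EO) ++ (i , l) ∷ map proj₂ (proj₁ sorted)))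
    ≡⟨ splitAtRow-first i l _ _ (++⁺ (All-reverse (EA ++ EB) (++⁺ EA-below EB-above)) (All-reverse EO EO-above)) ⟩
  map proj₂ (reverse (EA ++ EB) ++ reverse EO)
    ≡⟨ labels-reverse-++ (EA ++ EB) EO ⟩
  reverse (map proj₂ (EA ++ EB)) ++ reverse (map proj₂ EO)
    ≡⟨ cong₂ (λ u v → reverse u ++ reverse v) labels-EA++EB (labels-emptyOnes k (length tw) on) ⟩
  reverse (emptyTwoLabels k (A ++ B)) ++ reverse (emptyOneLabels k on)
    ≡⟨ cong (λ b → reverse (emptyTwoLabels k (A ++ B)) ++ reverse (if b then emptyOneLabels k on else emptyOneLabelsAbove k on))
         (sym (≡ᵇ-refl k)) ⟩
  precedingLabels k (A ++ B) ((k , l) ∷ on) ∎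
  where
  open ≡-Reasoning
  tw = A ++ (M , k , l) ∷ B
  S = filling tw on
  i = length A
  EA = emptyTwos k (indexed 0 (map twoRow A))
  EB = emptyTwos k (indexed (suc i) (map twoRow B))
  EO = emptyOnes k (indexed (length tw) (map oneRow on))
  HA = halfTwos k (indexed 0 (map twoRow A))
  HB = halfTwos k (indexed (suc i) (map twoRow B))
  sorted : ∃ λ zs → sortDesc (HA ++ (M , i , l) ∷ HB) ≡ (M , i , l) ∷ zs
  sorted = sortDesc-maximum HA (M , i , l) HB (++⁺ (halfTwos-below k M 0 A A<M) (halfTwos-below k M (suc i) B B<M))
  labels-EA++EB : map proj₂ (EA ++ EB) ≡ emptyTwoLabels k (A ++ B)
  labels-EA++EB = trans (map-++ proj₂ EA EB)
    (trans (cong₂ _++_ (labels-emptyTwos k 0 A) (labels-emptyTwos k (suc i) B)) (sym (emptyTwoLabels-++ k A B)))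
  EA-below : All (λ p → i ≢ proj₁ p) EA
  EA-below = All.map (λ { (_ , p<A) → >⇒≢ (subst (_ <_) (length-map twoRow A) p<A) })
    (All-emptyTwos k _ (indexed-bounds 0 (map twoRow A)))
  EB-above : All (λ p → i ≢ proj₁ p) EB
  EB-above = All.map (λ { (i<p , _) → <⇒≢ i<p }) (All-emptyTwos k _ (indexed-bounds (suc i) (map twoRow B)))
  EO-above : All (λ p → i ≢ proj₁ p) EO
  EO-above = All.map (λ { (tw≤p , _) → <⇒≢ (<-≤-trans (subst (i <_) (sym (length-++ A)) (m<m+n i z<s)) tw≤p) })
    (All-emptyOnes k _ (indexed-bounds (length tw) (map oneRow on)))

emptyTwoLabels-nonempty : ∀ {e a b l} A B → e < a ⊎ e < b →
  emptyTwoLabels e (A ++ (a , b , l) ∷ B) ≡ emptyTwoLabels e (A ++ B)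
emptyTwoLabels-nonempty {e} {a} {b} {l} A B e<a⊎e<b =
  trans (emptyTwoLabels-++ e A ((a , b , l) ∷ B))
    (trans (cong (emptyTwoLabels e A ++_) skip-row) (sym (emptyTwoLabels-++ e A B)))
  where
  row-nonempty : e < a ⊎ e < b → (a ≤ᵇ e) ∧ (b ≤ᵇ e) ≡ false
  row-nonempty (inj₁ e<a) rewrite >⇒≤ᵇ-false e<a = refl
  row-nonempty (inj₂ e<b) rewrite >⇒≤ᵇ-false e<b = ∧-zeroʳ (a ≤ᵇ e)
  skip-row : emptyTwoLabels e ((a , b , l) ∷ B) ≡ emptyTwoLabels e B
  skip-row rewrite row-nonempty e<a⊎e<b = refl

emptyOneLabels-nonempty : ∀ {e M l} A B → e < M → emptyOneLabels e (A ++ (M , l) ∷ B) ≡ emptyOneLabels e (A ++ B)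
emptyOneLabels-nonempty [] B e<M rewrite >⇒≤ᵇ-false e<M = refl
emptyOneLabels-nonempty {e} ((a , l) ∷ A) B e<M with a ≤ᵇ e
... | true = cong (l ∷_) (emptyOneLabels-nonempty A B e<M)
... | false = emptyOneLabels-nonempty A B e<M

emptyOneLabelsAbove-nonempty : ∀ {e M l} A B → e < M →
  emptyOneLabelsAbove e (A ++ (M , l) ∷ B) ≡ emptyOneLabelsAbove e (A ++ B)
emptyOneLabelsAbove-nonempty [] B e<M rewrite ≢⇒≡ᵇ-false (>⇒≢ e<M) = refl
emptyOneLabelsAbove-nonempty {e} ((a , l) ∷ A) B e<M with a ≡ᵇ e
... | true = emptyOneLabels-nonempty A B e<M
... | false = emptyOneLabelsAbove-nonempty A B e<M

precedingLabels-straighten : ∀ {e a b l j} A B on → e < a ⊎ e < b → j ≢ e →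
  precedingLabels e (A ++ B) ((j , l) ∷ on) ≡ precedingLabels e (A ++ (a , b , l) ∷ B) on
precedingLabels-straighten A B on e<a⊎e<b j≢e rewrite ≢⇒≡ᵇ-false j≢e =
  cong (λ t → reverse t ++ _) (sym (emptyTwoLabels-nonempty A B e<a⊎e<b))

precedingLabels-deleteOne : ∀ {e M l} tw A B → e < M →
  precedingLabels e tw (A ++ B) ≡ precedingLabels e tw (A ++ (M , l) ∷ B)
precedingLabels-deleteOne tw A B e<M = cong (λ t → _ ++ reverse t) (sym (emptyOneLabelsAbove-nonempty A B e<M))

-- Debts

InRange : ℕ → ℕ → Set
InRange n e = 1 ≤ e × e ≤ n

variableIndex : Factor → ℕ
variableIndex (xf k _) = k
variableIndex (yf k) = k

ValidFactor : ℕ → Factor → Set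
ValidFactor n f = InRange n (variableIndex f)

debtsOf : (ℕ → List ℕ) → List OneRow → List Factor
debtsOf G [] = []
debtsOf G ((e , _) ∷ on) = map (xf e) (G e) ++ debtsOf G on

debts : List TwoRow → List OneRow → List Factor
debts tw on = debtsOf (λ e → precedingLabels e tw on) on

debtsOf-++ : ∀ G xs ys → debtsOf G (xs ++ ys) ≡ debtsOf G xs ++ debtsOf G ys
debtsOf-++ G [] ys = refl
debtsOf-++ G ((e , _) ∷ xs) ys =
  trans (cong (map (xf e) (G e) ++_) (debtsOf-++ G xs ys)) (sym (++-assoc (map (xf e) (G e)) _ _))

debtsOf-cong : ∀ {G G'} on → All (λ e → G e ≡ G' e) (map proj₁ on) → debtsOf G on ≡ debtsOf G' on
debtsOf-cong [] [] = refl
debtsOf-cong ((e , _) ∷ on) (eq ∷ eqs) = cong₂ (λ u v → map (xf e) u ++ v) eq (debtsOf-cong on eqs)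

map-xf-valid : ∀ {n k} ls → InRange n k → All (ValidFactor n) (map (xf k) ls)
map-xf-valid [] _ = []
map-xf-valid (_ ∷ ls) k∈ = k∈ ∷ map-xf-valid ls k∈

debtsOf-valid : ∀ {n} G on → All (InRange n) (map proj₁ on) → All (ValidFactor n) (debtsOf G on)
debtsOf-valid G [] [] = []
debtsOf-valid G ((e , _) ∷ on) (e∈ ∷ on∈) = ++⁺ (map-xf-valid (G e) e∈) (debtsOf-valid G on on∈)

debts-straighten : ∀ {a b l j} A B on → All (λ e → e < a ⊎ e < b) (map proj₁ on) → All (j ≢_) (map proj₁ on) →
  debts (A ++ B) ((j , l) ∷ on)
    ≡ map (xf j) (precedingLabels j (A ++ B) ((j , l) ∷ on)) ++ debts (A ++ (a , b , l) ∷ B) on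
debts-straighten A B on on<row j∉on =
  cong (_ ++_) (debtsOf-cong on (All.zipWith (λ (e<row , j≢e) → precedingLabels-straighten A B on e<row j≢e) (on<row , j∉on)))

debts-deleteOne : ∀ {M l} tw A B → All (_< M) (map proj₁ (A ++ B)) →
  debts tw (A ++ (M , l) ∷ B) ↭ map (xf M) (precedingLabels M tw (A ++ (M , l) ∷ B)) ++ debts tw (A ++ B)
debts-deleteOne {M} {l} tw A B AB<M = begin
  debtsOf G (A ++ (M , l) ∷ B)        ≡⟨ debtsOf-++ G A ((M , l) ∷ B) ⟩
  debtsOf G A ++ (own ++ debtsOf G B)  ↭⟨ shifts (debtsOf G A) own ⟩
  own ++ (debtsOf G A ++ debtsOf G B)  ≡⟨ cong (own ++_) (sym (debtsOf-++ G A B)) ⟩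
  own ++ debtsOf G (A ++ B)
    ≡⟨ cong (own ++_) (debtsOf-cong (A ++ B) (All.map (λ e<M → sym (precedingLabels-deleteOne tw A B e<M)) AB<M)) ⟩
  own ++ debts tw (A ++ B)             ∎
  where
  open PermutationReasoning
  G = λ e → precedingLabels e tw (A ++ (M , l) ∷ B)
  own = map (xf M) (G M)

-- Factorisations of φ

-- F = ∏ D · (a product of linear factors in x₁…xₙ, y₁…yₙ), as an identity of multisets of factors.
record Covered (n : ℕ) (F : Frac) (D : List Factor) : Set where
  constructor covered
  field
    remainder : List Factor
    remainder-valid : All (ValidFactor n) remainder
    factorisation : proj₁ F ↭ proj₂ F ++ D ++ remainder

Covered-resp-↭ : ∀ {n F D D'} → D ↭ D' → Covered n F D → Covered n F D'
Covered-resp-↭ {F = F} D↭D' (covered R R-valid num↭) =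
  covered R R-valid (↭-trans num↭ (++⁺ˡ (proj₂ F) (++⁺ʳ R D↭D')))

discharge : ∀ {n F E D} → All (ValidFactor n) E → Covered n F (E ++ D) → Covered n F D
discharge {F = F} {E} {D} E-valid (covered R R-valid num↭) =
  covered (E ++ R) (++⁺ E-valid R-valid)
    (↭-trans num↭ (solve 4 (λ den E D R → den ⊕ (E ⊕ D) ⊕ R ⊜ den ⊕ D ⊕ E ⊕ R) ↭-refl (proj₂ F) E D R))
  where open ++-Solver Factor

cancel : ∀ {n F E D} N → All (ValidFactor n) N → Covered n F (E ++ D) → Covered n (F · (N , E)) D
cancel {F = F} {E} {D} N N-valid (covered R R-valid num↭) =
  covered (R ++ N) (++⁺ R-valid N-valid)
    (↭-trans (++⁺ʳ N num↭)
      (solve 5 (λ den E D R N → (den ⊕ (E ⊕ D) ⊕ R) ⊕ N ⊜ (den ⊕ E) ⊕ D ⊕ R ⊕ N) ↭-refl (proj₂ F) E D R N))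
  where open ++-Solver Factor

incur : ∀ {n F D} Z → Covered n F D → Covered n (F · (Z , [])) (Z ++ D)
incur {F = F} {D} Z (covered R R-valid num↭) =
  covered R R-valid
    (↭-trans (++⁺ʳ Z num↭) (solve 4 (λ den D R Z → (den ⊕ D ⊕ R) ⊕ Z ⊜ (den ⊕ id) ⊕ (Z ⊕ D) ⊕ R) ↭-refl (proj₂ F) D R Z))
  where open ++-Solver Factor

-- The two shapes of the denominator of E_S: empty (rectangular S), or exactly the debt E.
settle : ∀ {n F E D} N {Eden} → All (ValidFactor n) E → All (ValidFactor n) N → Eden ≡ [] ⊎ Eden ≡ E →
  Covered n F (E ++ D) → Covered n (F · (N , Eden)) D
settle N E-valid N-valid (inj₁ refl) c = cancel N N-valid (discharge E-valid c)
settle N _ N-valid (inj₂ refl) c = cancel N N-valid c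

prodℚ-++ : ∀ xs ys → prodℚ (xs ++ ys) ≡ prodℚ xs ℚ.* prodℚ ys
prodℚ-++ [] ys = sym (ℚ.*-identityˡ (prodℚ ys))
prodℚ-++ (x ∷ xs) ys = trans (cong (x ℚ.*_) (prodℚ-++ xs ys)) (sym (ℚ.*-assoc x (prodℚ xs) (prodℚ ys)))

prodℚ-↭ : ∀ {xs ys} → xs ↭ ys → prodℚ xs ≡ prodℚ ys
prodℚ-↭ xs↭ys = foldr-commMonoid (setoid ℚ) ℚ.*-1-isCommutativeMonoid (↭⇒↭ₛ xs↭ys)

module _ {n : ℕ} (α : ℕ → ℚ) (β₁ : ℚ) where

  factorPoly : ∀ f → ValidFactor n f → Poly n
  factorPoly (xf (suc k) j) (_ , k<n) = X (fromℕ< k<n) ⊕ con (ℚ.- α j)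
  factorPoly (yf (suc k)) (_ , k<n) = Y (fromℕ< k<n) ⊕ con (ℚ.- β₁)

  ⟦factorPoly⟧ : ∀ f valid x y → ⟦ factorPoly f valid ⟧ x y ≡ evalFactor α β₁ x y f
  ⟦factorPoly⟧ (xf (suc k) j) (_ , k<n) x y rewrite toℕ-fromℕ< k<n = refl
  ⟦factorPoly⟧ (yf (suc k)) (_ , k<n) x y rewrite toℕ-fromℕ< k<n = refl

  productPoly : ∀ fs → All (ValidFactor n) fs → Poly n
  productPoly [] [] = con ℚ.1ℚ
  productPoly (f ∷ fs) (valid ∷ valids) = factorPoly f valid ⊗ productPoly fs valids

  ⟦productPoly⟧ : ∀ fs valids x y → ⟦ productPoly fs valids ⟧ x y ≡ evalProd α β₁ x y fs
  ⟦productPoly⟧ [] [] x y = refl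
  ⟦productPoly⟧ (f ∷ fs) (valid ∷ valids) x y = cong₂ ℚ._*_ (⟦factorPoly⟧ f valid x y) (⟦productPoly⟧ fs valids x y)

  debtFree⇒isPolynomial : ∀ {F} → Covered n F [] → IsPolynomial n α β₁ F
  debtFree⇒isPolynomial {num , den} (covered R R-valid num↭) = productPoly R R-valid , quotient-identity
    where
    quotient-identity : ∀ x y → ⟦ productPoly R R-valid ⟧ x y ℚ.* evalProd α β₁ x y den ≡ evalProd α β₁ x y num
    quotient-identity x y = begin
      ⟦ productPoly R R-valid ⟧ x y ℚ.* ev den  ≡⟨ cong (ℚ._* ev den) (⟦productPoly⟧ R R-valid x y) ⟩
      ev R ℚ.* ev den                           ≡⟨ ℚ.*-comm (ev R) (ev den) ⟩
      ev den ℚ.* ev R                           ≡⟨ sym (prodℚ-++ (map value den) (map value R)) ⟩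
      prodℚ (map value den ++ map value R)      ≡⟨ cong prodℚ (sym (map-++ value den R)) ⟩
      ev (den ++ R)                             ≡⟨ sym (prodℚ-↭ (map⁺ value num↭)) ⟩
      ev num                                    ∎
      where
      open ≡-Reasoning
      value = evalFactor α β₁ x y
      ev = evalProd α β₁ x y

  covered⇒isPolynomial : ∀ {F D} → All (ValidFactor n) D → Covered n F D → IsPolynomial n α β₁ F
  covered⇒isPolynomial {F} {D} D-valid c =
    debtFree⇒isPolynomial (discharge D-valid (subst (Covered n F) (sym (++-identityʳ D)) c))

applyDownFrom-suc-inRange : ∀ m → All (InRange m) (applyDownFrom suc m)
applyDownFrom-suc-inRange m = applyDownFrom⁺₁ suc m (λ i<m → s≤s z≤n , i<m)

applyDownFrom-suc-unique : ∀ m → Unique (applyDownFrom suc m)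
applyDownFrom-suc-unique m = Unique.applyDownFrom⁺₁ suc m (λ j<i _ i≡j → <⇒≢ j<i (sym (suc-injective i≡j)))

upTo-↭-applyDownFrom : ∀ m → map suc (upTo m) ↭ applyDownFrom suc m
upTo-↭-applyDownFrom m = begin
  map suc (upTo m)            ↭⟨ ↭-sym (↭-reverse (map suc (upTo m))) ⟩
  reverse (map suc (upTo m))  ≡⟨ sym (reverse-map suc (upTo m)) ⟩
  map suc (reverse (upTo m))  ≡⟨ cong (map suc) (reverse-upTo m) ⟩
  map suc (downFrom m)        ≡⟨ map-downFrom suc m ⟩
  applyDownFrom suc m         ∎
  where open PermutationReasoning

Unique-++⁻ʳ : ∀ (xs : List ℕ) {ys} → Unique (xs ++ ys) → Unique ys
Unique-++⁻ʳ [] unique = unique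
Unique-++⁻ʳ (_ ∷ xs) (_ ∷ unique) = Unique-++⁻ʳ xs unique

phi-step : ∀ m S {S' loc} → delete (suc (suc m)) S ≡ S' → locate (suc (suc m)) S ≡ loc →
  phi (suc (suc m)) S ≡ phi (suc m) S' · stepFactor (suc (suc m)) S loc
phi-step m S refl refl = refl

Efactor-column₁-denominator : ∀ N S i k →
  proj₂ (Efactor N S (inCol1 i k)) ≡ [] ⊎ proj₂ (Efactor N S (inCol1 i k)) ≡ map (xf k) (proj₁ (splitAtRow i (pref k S)))
Efactor-column₁-denominator N S i k with isRectangle S
... | true = inj₁ refl
... | false = inj₂ refl

Efactor-column₁-valid : ∀ {n} N S i k → InRange n k → All (ValidFactor n) (proj₁ (Efactor N S (inCol1 i k)))
Efactor-column₁-valid N S i k k∈ with isRectangle S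
... | true = k∈ ∷ []
... | false = k∈ ∷ map-xf-valid _ k∈

-- S = filling (A ++ (a , b , l) ∷ B) on, with M = m + 2 in {a, b} and j the other entry of its row,
-- so that S ∖ M = filling (A ++ B) ((j , l) ∷ on).
module Straightening {n m : ℕ} (A B : List TwoRow) (j l : ℕ) (on : List OneRow) (m+2≤n : suc (suc m) ≤ n)
  (standard : entries (A ++ B) ((j , l) ∷ on) ↭ applyDownFrom suc (suc m)) where

  M : ℕ
  M = suc (suc m)

  private
    inRange : All (InRange (suc m)) (entries (A ++ B) ((j , l) ∷ on))
    inRange = All-resp-↭ (↭-sym standard) (applyDownFrom-suc-inRange (suc m))
    twos-inRange : All (InRange (suc m)) (twoEntries A ++ twoEntries B)
    twos-inRange = subst (All _) (twoEntries-++ A B) (++⁻ˡ (twoEntries (A ++ B)) inRange)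
    rest-inRange : All (InRange (suc m)) (j ∷ map proj₁ on)
    rest-inRange = ++⁻ʳ (twoEntries (A ++ B)) inRange
    below : ∀ {e} → InRange (suc m) e → e < M
    below (_ , e≤) = s≤s e≤
    widen : ∀ {e} → InRange (suc m) e → InRange n e
    widen (1≤e , e≤) = 1≤e , ≤-trans e≤ (≤-trans (n≤1+n _) m+2≤n)

  A<M : All (_< M) (twoEntries A)
  A<M = All.map below (++⁻ˡ (twoEntries A) twos-inRange)

  B<M : All (_< M) (twoEntries B)
  B<M = All.map below (++⁻ʳ (twoEntries A) twos-inRange)

  j<M : j < M
  j<M = below (All.head rest-inRange)

  on<M : All (_< M) (map proj₁ on)
  on<M = All.map below (All.tail rest-inRange)

  j∉on : All (j ≢_) (map proj₁ on)
  j∉on with Unique-++⁻ʳ (twoEntries (A ++ B))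
              (Unique-resp-↭ (setoid ℕ) (↭⇒↭ₛ (↭-sym standard)) (applyDownFrom-suc-unique (suc m)))
  ... | j∉ ∷ _ = j∉

  j-inRange : InRange n j
  j-inRange = widen (All.head rest-inRange)

  M-inRange : InRange n M
  M-inRange = s≤s z≤n , m+2≤n

  debt : List Factor
  debt = map (xf j) (precedingLabels j (A ++ B) ((j , l) ∷ on))

  debt-valid : All (ValidFactor n) debt
  debt-valid = map-xf-valid _ j-inRange

  covered-straightened : ∀ {a b} → All (λ e → e < a ⊎ e < b) (map proj₁ on) →
    Covered n (phi (suc m) (filling (A ++ B) ((j , l) ∷ on))) (debts (A ++ B) ((j , l) ∷ on)) →
    Covered n (phi (suc m) (filling (A ++ B) ((j , l) ∷ on))) (debt ++ debts (A ++ (a , b , l) ∷ B) on)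
  covered-straightened on<row =
    subst (Covered n _) (debts-straighten A B on on<row j∉on)

  covered-column₁ : Covered n (phi (suc m) (filling (A ++ B) ((j , l) ∷ on))) (debts (A ++ B) ((j , l) ∷ on)) →
    Covered n (phi M (filling (A ++ (M , j , l) ∷ B) on)) (debts (A ++ (M , j , l) ∷ B) on)
  covered-column₁ smaller =
    subst (λ F → Covered n F (debts tw on)) (sym (phi-step m S (delete-column₁ A A<M) (locate-column₁ A A<M)))
      (settle (map (xf M) P ++ proj₁ E) debt-valid
        (++⁺ (map-xf-valid P M-inRange) (Efactor-column₁-valid M S (length A) j j-inRange))
        denominator (covered-straightened (All.map inj₁ on<M) smaller))
    where
    tw = A ++ (M , j , l) ∷ B
    S = filling tw on
    P = proj₁ (splitAtRow (length A) (pref M S))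
    E = Efactor M S (inCol1 (length A) j)
    denominator : proj₂ E ≡ [] ⊎ proj₂ E ≡ debt
    denominator = Sum.map₂ (λ E≡ → trans E≡ (cong (map (xf j)) (preceding-partner A B j<M A<M B<M)))
      (Efactor-column₁-denominator M S (length A) j)

  covered-column₂ : Covered n (phi (suc m) (filling (A ++ B) ((j , l) ∷ on))) (debts (A ++ B) ((j , l) ∷ on)) →
    Covered n (phi M (filling (A ++ (j , M , l) ∷ B) on)) (debts (A ++ (j , M , l) ∷ B) on)
  covered-column₂ smaller =
    subst (λ F → Covered n F (debts tw on)) (sym (phi-step m S (delete-column₂ A A<M j<M) (locate-column₂ A A<M j<M)))
      (settle (map (xf M) P ++ []) debt-valid (++⁺ (map-xf-valid P M-inRange) []) (inj₁ refl)
        (covered-straightened (All.map inj₂ on<M) smaller))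
    where
    tw = A ++ (j , M , l) ∷ B
    S = filling tw on
    P = proj₁ (splitAtRow (length A) (pref M S))

covered-oneRow : ∀ {n m l} tw A B → suc (suc m) ≤ n → entries tw (A ++ B) ↭ applyDownFrom suc (suc m) →
  Covered n (phi (suc m) (filling tw (A ++ B))) (debts tw (A ++ B)) →
  Covered n (phi (suc (suc m)) (filling tw (A ++ (suc (suc m) , l) ∷ B))) (debts tw (A ++ (suc (suc m) , l) ∷ B))
covered-oneRow {n} {m} {l} tw A B m+2≤n standard smaller =
  subst (λ F → Covered n F (debts tw on)) (sym (phi-step m S (delete-oneRow tw A tw<M A<M) (locate-oneRow tw A tw<M A<M)))
    (Covered-resp-↭ owed↭ (incur (map (xf M) P ++ []) smaller))
  where
  M = suc (suc m)
  on = A ++ (M , l) ∷ B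
  S = filling tw on
  P = proj₁ (splitAtRow (length tw + length A) (pref M S))
  below : All (_< M) (entries tw (A ++ B))
  below = All.map (λ (_ , e≤) → s≤s e≤) (All-resp-↭ (↭-sym standard) (applyDownFrom-suc-inRange (suc m)))
  tw<M : All (_< M) (twoEntries tw)
  tw<M = ++⁻ˡ (twoEntries tw) below
  AB<M : All (_< M) (map proj₁ (A ++ B))
  AB<M = ++⁻ʳ (twoEntries tw) below
  A<M : All (_< M) (map proj₁ A)
  A<M = ++⁻ˡ (map proj₁ A) (subst (All _) (map-++ proj₁ A B) AB<M)
  owed↭ : (map (xf M) P ++ []) ++ debts tw (A ++ B) ↭ debts tw on
  owed↭ = begin
    (map (xf M) P ++ []) ++ debts tw (A ++ B)
      ≡⟨ cong (_++ debts tw (A ++ B)) (trans (++-identityʳ _) (cong (map (xf M)) (preceding-oneRow M l tw A B A<M))) ⟩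
    map (xf M) (precedingLabels M tw on) ++ debts tw (A ++ B)
      ↭⟨ ↭-sym (debts-deleteOne tw A B AB<M) ⟩
    debts tw on ∎
    where open PermutationReasoning

data Occurrence (M : ℕ) : List TwoRow → List OneRow → Set where
  inColumn₁ : ∀ A j l B on → Occurrence M (A ++ (M , j , l) ∷ B) on
  inColumn₂ : ∀ A j l B on → Occurrence M (A ++ (j , M , l) ∷ B) on
  inSingleRow : ∀ tw A l B → Occurrence M tw (A ++ (M , l) ∷ B)

occurrence-oneRows : ∀ {M} tw on → M ∈ map proj₁ on → Occurrence M tw on
occurrence-oneRows tw ((_ , l) ∷ on) (here refl) = inSingleRow tw [] l on
occurrence-oneRows tw (r ∷ on) (there M∈on) with occurrence-oneRows tw on M∈on
... | inColumn₁ A j l B _ = inColumn₁ A j l B (r ∷ on)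
... | inColumn₂ A j l B _ = inColumn₂ A j l B (r ∷ on)
... | inSingleRow _ A l B = inSingleRow tw (r ∷ A) l B

occurrence : ∀ {M} tw on → M ∈ entries tw on → Occurrence M tw on
occurrence [] on M∈ = occurrence-oneRows [] on M∈
occurrence ((_ , b , l) ∷ tw) on (here refl) = inColumn₁ [] b l tw on
occurrence ((a , _ , l) ∷ tw) on (there (here refl)) = inColumn₂ [] a l tw on
occurrence (r ∷ tw) on (there (there M∈)) with occurrence tw on M∈
... | inColumn₁ A j l B _ = inColumn₁ (r ∷ A) j l B on
... | inColumn₂ A j l B _ = inColumn₂ (r ∷ A) j l B on
... | inSingleRow _ A l B = inSingleRow (r ∷ tw) A l B

covered-standard : ∀ {n} m tw on → suc m ≤ n → entries tw on ↭ applyDownFrom suc (suc m) →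
  Covered n (phi (suc m) (filling tw on)) (debts tw on)
covered-standard zero (_ ∷ _) on _ standard with ↭-length standard
... | ()
covered-standard zero [] [] _ standard with ↭-length standard
... | ()
covered-standard zero [] (_ ∷ _ ∷ _) _ standard with ↭-length standard
... | ()
covered-standard zero [] ((e , l) ∷ []) _ standard with ∈-resp-↭ standard (here refl)
... | here refl = covered [] [] ↭-refl
covered-standard (suc m) tw on m+2≤n standard with occurrence tw on (∈-resp-↭ (↭-sym standard) (here refl))
... | inColumn₁ A j l B on =
  Straightening.covered-column₁ A B j l on m+2≤n smaller (covered-standard m (A ++ B) ((j , l) ∷ on) (<⇒≤ m+2≤n) smaller)
  where
  smaller : entries (A ++ B) ((j , l) ∷ on) ↭ applyDownFrom suc (suc m)
  smaller = drop-∷ (↭-trans (↭-sym (entries-column₁ A B on)) standard)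
... | inColumn₂ A j l B on =
  Straightening.covered-column₂ A B j l on m+2≤n smaller (covered-standard m (A ++ B) ((j , l) ∷ on) (<⇒≤ m+2≤n) smaller)
  where
  smaller : entries (A ++ B) ((j , l) ∷ on) ↭ applyDownFrom suc (suc m)
  smaller = drop-∷ (↭-trans (↭-sym (entries-column₂ A B on)) standard)
... | inSingleRow tw A l B =
  covered-oneRow tw A B m+2≤n smaller (covered-standard m tw (A ++ B) (<⇒≤ m+2≤n) smaller)
  where
  smaller : entries tw (A ++ B) ↭ applyDownFrom suc (suc m)
  smaller = drop-∷ (↭-trans (↭-sym (entries-oneRow tw A B)) standard)

proposition3p2 : (a b : ℕ) → b ≤ a → 1 ≤ a →
    (α β : ℕ → ℚ) → DistinctOn (a + b) α → DistinctOn (a + b) β →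
    (c₁ : Vec ℕ a) (c₂ : Vec ℕ b) →
    (toList c₁ ++ toList c₂) ↭ map suc (upTo (a + b)) →
    IsPolynomial (a + b) α (β 1) (phi (a + b) (stdFilling c₁ c₂))
proposition3p2 a@(suc a-1) b b≤a _ α β _ _ c₁ c₂ columns↭
  with stdFillingFrom-filling 1 (toList c₁) (toList c₂)
         (subst₂ _≤_ (sym (length-toList c₂)) (sym (length-toList c₁)) b≤a)
... | tw , on , S≡ , entries↭ =
  subst (λ S → IsPolynomial (a + b) α (β 1) (phi (a + b) S)) (sym S≡)
    (covered⇒isPolynomial α (β 1) debts-valid (covered-standard (a-1 + b) tw on ≤-refl standard))
  where
  standard : entries tw on ↭ applyDownFrom suc (a + b)
  standard = ↭-trans entries↭ (↭-trans columns↭ (upTo-↭-applyDownFrom (a + b)))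
  debts-valid : All (ValidFactor (a + b)) (debts tw on)
  debts-valid = debtsOf-valid _ on (++⁻ʳ (twoEntries tw) (All-resp-↭ (↭-sym standard) (applyDownFrom-suc-inRange (a + b))))
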